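{- Let $\mathbf{s}=(s_1,\dots,s_n)$ be a sequence of positive integers with $s_1=1$, and $\mathbf{s}^*=(s_1,\dots,s_n,1)$. For every $\mathbf{r}\in\Psi_n$, \[\operatorname{des}_{\mathbf{s}^*}(\mathbf{r},0)=\operatorname{asc}_{\mathbf{s}^*}(\Phi_{\mathbf{s}}(\mathbf{r}),0)=\operatorname{asc}_{\mathbf{s}}(\Phi_{\mathbf{s}}(\mathbf{r})).\]
   Context: $\langle N\rangle=\{0,\dots,N\}$, $\Psi_n=\langle s_1-1\rangle\times\cdots\times\langle s_n-1\rangle$. $\Phi_{\mathbf{s}}:\Psi_n\to\Psi_n$ sends $(r_1,\dots,r_n)$ to $(z_1,\dots,z_n)$ with $z_i\in\langle s_i-1\rangle$ and $r_i+z_i\equiv0\pmod{s_i}$. For a sequence $\mathbf{t}=(t_1,\dots,t_m)$ of positive integers and $\mathbf{r}\in\mathbb{N}^m$: $\operatorname{des}_{\mathbf{t}}(\mathbf{r})=\#\{i\le m-1:r_i/t_i>r_{i+1}/t_{i+1}\}$ and $\operatorname{asc}_{\mathbf{t}}(\mathbf{r})=\#\{i\le m-1:r_i/t_i<r_{i+1}/t_{i+1}\}$. $(\mathbf{r},0)$ denotes $\mathbf{r}$ with a $0$ appended. -}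

module Defs where

open import Data.Nat using (ℕ; zero; suc; _+_; _*_; _∸_; _<_; _<ᵇ_; NonZero)
open import Data.Nat.DivMod using (_%_)
open import Data.Bool using (Bool; true; false; if_then_else_)
open import Data.List using (List; []; _∷_; _++_; [_]; length)
open import Data.Product using (_×_; _,_)
open import Data.List.Relation.Unary.All using (All)
open import Data.List.Relation.Binary.Pointwise using (Pointwise)

-- A sequence t = (t_1,...,t_m) of positive integers is a list of naturals
-- (positivity is a separate hypothesis). r ∈ ℕ^m is a list of the same length.

-- Comparison of fractions a/b < c/d for b,d > 0, by cross-multiplication:
-- a/b < c/d  iff  a*d < c*b.
fracLt : ℕ → ℕ → ℕ → ℕ → Bool
fracLt a b c d = (a * d) <ᵇ (c * b)

des : List ℕ → List ℕ → ℕ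
des (t₁ ∷ t₂ ∷ ts) (r₁ ∷ r₂ ∷ rs) =
  (if fracLt r₂ t₂ r₁ t₁ then 1 else 0) + des (t₂ ∷ ts) (r₂ ∷ rs)
des _ _ = 0

asc : List ℕ → List ℕ → ℕ
asc (t₁ ∷ t₂ ∷ ts) (r₁ ∷ r₂ ∷ rs) =
  (if fracLt r₁ t₁ r₂ t₂ then 1 else 0) + asc (t₂ ∷ ts) (r₂ ∷ rs)
asc _ _ = 0

InΨ : List ℕ → List ℕ → Set
InΨ s r = Pointwise (λ rᵢ sᵢ → rᵢ < sᵢ) r s

-- For positive s_i and r_i < s_i, z_i ∈ ⟨s_i - 1⟩ with r_i + z_i ≡ 0 mod s_i
-- is z_i = (s_i - r_i) mod s_i.
negMod : ℕ → ℕ → ℕ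
negMod zero    r = 0
negMod (suc k) r = (suc k ∸ r) % suc k

Φ : List ℕ → List ℕ → List ℕ
Φ (sᵢ ∷ s) (rᵢ ∷ r) = negMod sᵢ rᵢ ∷ Φ s r
Φ _ _ = []

Positive : ℕ → Set
Positive n = 0 < n

module Submission where

-- Write [P] for the 0/1 indicator of P and z = Φ_t(r), so that
-- z_i = 0 when r_i = 0 and z_i = t_i - r_i otherwise.  Since t_i - r_i and
-- t_{i+1} - r_{i+1} are complements, for two neighbouring positions
--
--   [r_{i+1}/t_{i+1} < r_i/t_i] + [r_{i+1} > 0]  =  [r_i > 0] + [z_i/t_i < z_{i+1}/t_{i+1}]
--
-- (the exchange identity below; the indicators [r > 0] absorb the cases where
-- one of the entries is 0 and the complement is not taken).  Summing it along
-- the sequence telescopes: for any weights t and any r ∈ Ψ with a 0 appended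
-- under weight 1, des_{t,1}(r,0) = [r_1 > 0] + asc_{t,1}(Φ_t(r),0).  When
-- t_1 = 1 the entry r_1 must be 0, which gives the first equation.  The second
-- one holds because a final entry 0/1 is minimal, so it never ends an ascent.

open import Defs
open import Data.Nat using (ℕ; zero; suc; _+_; _*_; _∸_; _≤_; _<_; _<ᵇ_; z≤n; s≤s)
open import Data.Nat.Properties
  using (+-assoc; +-comm; *-comm; *-distribʳ-∸; *-monoˡ-≤; ∸-monoʳ-<; ∸-cancelʳ-<;
         m∸n≤m; m<n⇒0<n∸m; <ᵇ⇒<; <⇒<ᵇ; <⇒≤)
open import Data.Nat.DivMod using (m%n<n; m<n⇒m%n≡m; n%n≡0)
open import Data.Bool using (Bool; true; false; if_then_else_)
open import Data.Bool.Properties using (T-≡; ⇔→≡)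
open import Data.List using (List; []; _∷_; _++_; [_])
open import Data.List.Relation.Unary.All using (All)
open import Data.List.Relation.Binary.Pointwise using (Pointwise; []; _∷_)
open import Data.Product using (_×_; _,_)
open import Function.Bundles using (mk⇔; Equivalence)
open import Relation.Binary.PropositionalEquality using (_≡_; refl; sym; trans; cong; cong₂; module ≡-Reasoning)

𝟙 : Bool → ℕ
𝟙 b = if b then 1 else 0

𝟙>0 : ℕ → ℕ
𝟙>0 zero    = 0
𝟙>0 (suc _) = 1

<ᵇ-cong : ∀ m n p q → (m < n → p < q) → (p < q → m < n) → (m <ᵇ n) ≡ (p <ᵇ q)
<ᵇ-cong m n p q to from = ⇔→≡ {z = true} (mk⇔
  (λ e → Equivalence.to T-≡ (<⇒<ᵇ (to (<ᵇ⇒< m n (Equivalence.from T-≡ e)))))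
  (λ e → Equivalence.to T-≡ (<⇒<ᵇ (from (<ᵇ⇒< p q (Equivalence.from T-≡ e))))))

fracLt-complement : ∀ r t r' t' → r ≤ t → r' ≤ t' →
  fracLt r' t' r t ≡ fracLt (t ∸ r) t (t' ∸ r') t'
fracLt-complement r t r' t' r≤t r'≤t' =
  begin
    (r' * t <ᵇ r * t')
  ≡⟨ <ᵇ-cong (r' * t) (r * t') (t * t' ∸ r * t') (t * t' ∸ r' * t)
       (λ lt → ∸-monoʳ-< lt (*-monoˡ-≤ t' r≤t)) ∸-cancelʳ-< ⟩
    (t * t' ∸ r * t' <ᵇ t * t' ∸ r' * t)
  ≡⟨ cong₂ _<ᵇ_ (sym (*-distribʳ-∸ t' t r))
       (trans (cong (_∸ r' * t) (*-comm t t')) (sym (*-distribʳ-∸ t t' r'))) ⟩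
    ((t ∸ r) * t' <ᵇ (t' ∸ r') * t)
  ∎
  where open ≡-Reasoning

fracLt-zero-positive : ∀ {b c} d → 0 < b → 0 < c → fracLt 0 b c d ≡ true
fracLt-zero-positive {suc _} {suc _} _ _ _ = refl

negMod-zero : ∀ t → negMod t 0 ≡ 0
negMod-zero zero    = refl
negMod-zero (suc k) = n%n≡0 (suc k)

negMod-positive : ∀ {t r} → 0 < r → r < t → negMod t r ≡ t ∸ r
negMod-positive {suc k} {suc r} _ (s≤s r≤k) = m<n⇒m%n≡m (s≤s (m∸n≤m k r))

negMod-< : ∀ {t r} → r < t → negMod t r < t
negMod-< {suc k} {r} _ = m%n<n (suc k ∸ r) (suc k)

Φ-maps-Ψ : ∀ t r → InΨ t r → InΨ t (Φ t r)
Φ-maps-Ψ []      []      []         = []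
Φ-maps-Ψ (_ ∷ t) (_ ∷ r) (lt ∷ lts) = negMod-< lt ∷ Φ-maps-Ψ t r lts

exchange : ∀ r t r' t' → r < t → r' < t' →
  𝟙 (fracLt r' t' r t) + 𝟙>0 r' ≡ 𝟙>0 r + 𝟙 (fracLt (negMod t r) t (negMod t' r') t')
exchange zero t zero t' _ _
  rewrite negMod-zero t | negMod-zero t' = refl
exchange zero t (suc r') t' 0<t r'<t'
  rewrite negMod-zero t | negMod-positive (s≤s z≤n) r'<t'
        | fracLt-zero-positive t' 0<t (m<n⇒0<n∸m r'<t') = refl
exchange (suc r) t zero (suc t') r<t _
  rewrite negMod-positive (s≤s z≤n) r<t | negMod-zero (suc t') = refl
exchange (suc r) t (suc r') t' r<t r'<t'
  rewrite negMod-positive (s≤s z≤n) r<t | negMod-positive (s≤s z≤n) r'<t'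
        | fracLt-complement (suc r) t (suc r') t' (<⇒≤ r<t) (<⇒≤ r'<t') = +-comm _ 1

des-telescopes : ∀ t ts r rs → InΨ (t ∷ ts) (r ∷ rs) →
  des ((t ∷ ts) ++ [ 1 ]) ((r ∷ rs) ++ [ 0 ]) ≡
  𝟙>0 r + asc ((t ∷ ts) ++ [ 1 ]) (Φ (t ∷ ts) (r ∷ rs) ++ [ 0 ])
des-telescopes t [] zero    [] (_ ∷ []) = refl
des-telescopes t [] (suc _) [] (_ ∷ []) = refl
des-telescopes t (t' ∷ ts) r (r' ∷ rs) (r<t ∷ r'<t' ∷ lts) =
  begin
    𝟙 (fracLt r' t' r t) + des ((t' ∷ ts) ++ [ 1 ]) ((r' ∷ rs) ++ [ 0 ])
  ≡⟨ cong (𝟙 (fracLt r' t' r t) +_) (des-telescopes t' ts r' rs (r'<t' ∷ lts)) ⟩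
    𝟙 (fracLt r' t' r t) + (𝟙>0 r' + rest)
  ≡⟨ sym (+-assoc (𝟙 (fracLt r' t' r t)) (𝟙>0 r') rest) ⟩
    𝟙 (fracLt r' t' r t) + 𝟙>0 r' + rest
  ≡⟨ cong (_+ rest) (exchange r t r' t' r<t r'<t') ⟩
    𝟙>0 r + 𝟙 (fracLt (negMod t r) t (negMod t' r') t') + rest
  ≡⟨ +-assoc (𝟙>0 r) _ rest ⟩
    𝟙>0 r + (𝟙 (fracLt (negMod t r) t (negMod t' r') t') + rest)
  ∎
  where
  open ≡-Reasoning
  rest : ℕ
  rest = asc ((t' ∷ ts) ++ [ 1 ]) (Φ (t' ∷ ts) (r' ∷ rs) ++ [ 0 ])

-- A final entry 0 of weight 1 is minimal, so appending it creates no ascent.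
asc-append-zero : ∀ {R : ℕ → ℕ → Set} t z → Pointwise R z t →
  asc (t ++ [ 1 ]) (z ++ [ 0 ]) ≡ asc t z
asc-append-zero []               []               []              = refl
asc-append-zero (_ ∷ [])         (_ ∷ [])         (_ ∷ [])        = refl
asc-append-zero (t ∷ t' ∷ ts) (z ∷ z' ∷ zs) (_ ∷ rel' ∷ rels) =
  cong (𝟙 (fracLt z t z' t') +_) (asc-append-zero (t' ∷ ts) (z' ∷ zs) (rel' ∷ rels))

lemma6p1 : (s' : List ℕ) → All Positive (1 ∷ s') → (r : List ℕ) → InΨ (1 ∷ s') r →
    (des ((1 ∷ s') ++ [ 1 ]) (r ++ [ 0 ]) ≡ asc ((1 ∷ s') ++ [ 1 ]) (Φ (1 ∷ s') r ++ [ 0 ]))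
    × (asc ((1 ∷ s') ++ [ 1 ]) (Φ (1 ∷ s') r ++ [ 0 ]) ≡ asc (1 ∷ s') (Φ (1 ∷ s') r))
-- Since s_1 = 1 forces r_1 = 0, the telescoped identity has no boundary term.
lemma6p1 s' _ (zero ∷ rs) r∈Ψ =
  des-telescopes 1 s' zero rs r∈Ψ ,
  asc-append-zero (1 ∷ s') (Φ (1 ∷ s') (zero ∷ rs)) (Φ-maps-Ψ (1 ∷ s') (zero ∷ rs) r∈Ψ)
lemma6p1 s' _ (suc _ ∷ rs) (s≤s () ∷ _)
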